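{- Let $(G,o)$ be a rooted, simple, locally finite, connected graph, let $\Gamma\le\mathrm{AUT}(G)$, and let $(T,\mathcal{V},r)$ be a rooted tree decomposition of $(G,o)$ such that $(T,\mathcal{V})$ is $\Gamma$-invariant. Let $s,t\in V(T)$ and let $\gamma\in\Gamma$ witness the cone equivalence of $s$ and $t$. Then $\gamma$ can be extended to a graph isomorphism between $\mathcal{G}(s)$ and $\mathcal{G}(t)$.
   Context: Tree decomposition $(T,\mathcal{V})$: $T$ a tree, $\mathcal{V}:V(T)\to2^{V(G)}$, parts cover $V(G)$, every edge of $G$ lies within some part, $\mathcal{V}(s)\cap\mathcal{V}(t)\subseteq\mathcal{V}(u)$ for $u$ on the $s$–$t$ path. $\Gamma$-invariant: there is an action of $\Gamma$ on $T$ with $\gamma(\mathcal{V}(t))=\mathcal{V}(\gamma t)$. Rooted: a vertex $r$ with $o\in\mathcal{V}(r)$; $t^\uparrow$ is the parent of $t\neq r$. Adhesion set $\mathcal{V}(s,t)=\mathcal{V}(s)\cap\mathcal{V}(t)$. Let $\mathcal{E}(r)=E(G[\mathcal{V}(r)])$ and $\mathcal{E}(t)=E(G[\mathcal{V}(t)])\setminus E(G[\mathcal{V}(t^\uparrow)])$ for $t\ne r$. For every edge $st$ of $T$, $\mathcal{E}(s,t)$ is a set of new (virtual) edges making $\mathcal{V}(s,t)$ a complete graph. The $t$-graph is $\mathcal{G}(t)=(\mathcal{V}(t),\mathcal{E}(t)\uplus\biguplus_{s\text{ adjacent to }t}\mathcal{E}(s,t))$. Two vertices $s,t\ne r$ are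 cone-equivalent if some $\gamma\in\Gamma$ maps $s$ to $t$ and $s^\uparrow$ to $t^\uparrow$ (such $\gamma$ witnesses the cone equivalence); $r$ is cone-equivalent only to itself (witnessed by any $\gamma$ fixing $r$). -}

module Defs where

open import Level using (0ℓ)
open import Data.Empty using (⊥)
open import Data.Unit using (⊤; tt)
open import Data.Product using (Σ; ∃; _×_; _,_; proj₁; proj₂)
open import Data.Sum using (_⊎_; inj₁; inj₂)
open import Data.List using (List; []; _∷_)
open import Data.List.Membership.Propositional using () renaming (_∈_ to _∈L_)
open import Data.List.Relation.Unary.Unique.Propositional using (Unique)
open import Relation.Nullary using (¬_)
open import Relation.Binary.PropositionalEquality using (_≡_; _≢_; refl; sym; trans)
open import Relation.Binary.Bundles using (Setoid)
open import Algebra.Bundles using (Group)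
open import Function.Bundles using (Inverse)

IsWalk : {A : Set} (R : A → A → Set) → A → List A → A → Set
IsWalk R a []       b = a ≡ b
IsWalk R a (x ∷ xs) b = R a x × IsWalk R x xs b

IsPath : {A : Set} (R : A → A → Set) → A → List A → A → Set
IsPath R a xs b = IsWalk R a xs b × Unique (a ∷ xs)

-- Graphs given by an adjacency relation (so no multiple edges).

record IsSimpleGraph {V : Set} (_~_ : V → V → Set) : Set where
  field
    irrefl : ∀ v → ¬ (v ~ v)
    sym~   : ∀ {u v} → u ~ v → v ~ u

LocallyFinite : {V : Set} (_~_ : V → V → Set) → Set
LocallyFinite {V} _~_ = ∀ v → Σ (List V) λ ns → ∀ w → v ~ w → w ∈L ns

Connected : {V : Set} (_~_ : V → V → Set) → Set
Connected {V} _~_ = ∀ a b → Σ (List V) λ xs → IsWalk _~_ a xs b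

record IsTree {N : Set} (_~_ : N → N → Set) : Set where
  field
    simple      : IsSimpleGraph _~_
    connected   : Connected _~_
    uniquePaths : ∀ {a b xs ys} → IsPath _~_ a xs b → IsPath _~_ a ys b → xs ≡ ys

Parent : {N : Set} (_~T_ : N → N → Set) (r t p : N) → Set
Parent {N} _~T_ r t p = Σ (List N) λ xs → IsPath _~T_ t (p ∷ xs) r

record IsTreeDecomposition {V N : Set} (_~_ : V → V → Set) (_~T_ : N → N → Set)
                           (𝒱 : N → V → Set) : Set where
  field
    covers     : ∀ v → Σ N λ t → 𝒱 t v
    edgesIn    : ∀ u v → u ~ v → Σ N λ t → 𝒱 t u × 𝒱 t v
    pathAxiom  : ∀ s t xs → IsPath _~T_ s xs t → ∀ u → u ∈L (s ∷ xs) →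
                 ∀ v → 𝒱 s v → 𝒱 t v → 𝒱 u v

record Action (Γ : Group 0ℓ 0ℓ) {X : Set} (_~_ : X → X → Set) : Set where
  open Group Γ
  field
    act      : Carrier → X → X
    act-cong : ∀ {g h} → g ≈ h → ∀ x → act g x ≡ act h x
    act-ε    : ∀ x → act ε x ≡ x
    act-∙    : ∀ g h x → act (g ∙ h) x ≡ act g (act h x)
    act-adj  : ∀ g x y → (x ~ y → act g x ~ act g y) × (act g x ~ act g y → x ~ y)

-- faithful action: Γ is (isomorphic to) a subgroup of the automorphism group
Faithful : {Γ : Group 0ℓ 0ℓ} {X : Set} {_~_ : X → X → Set} → Action Γ _~_ → Set
Faithful {Γ} {X} α = ∀ g h → (∀ x → act g x ≡ act h x) → g ≈ h
  where open Group Γ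
        open Action α

Invariant : {Γ : Group 0ℓ 0ℓ} {V N : Set} {_~_ : V → V → Set} {_~T_ : N → N → Set} →
            Action Γ _~_ → Action Γ _~T_ → (N → V → Set) → Set
Invariant {Γ} {V} αG αT 𝒱 =
  ∀ g t → (∀ v → 𝒱 t v → 𝒱 (Action.act αT g t) (Action.act αG g v))
        × (∀ w → 𝒱 (Action.act αT g t) w → Σ V λ v → 𝒱 t v × Action.act αG g v ≡ w)
  where open Group Γ

ConeWitness : {Γ : Group 0ℓ 0ℓ} {N : Set} (_~T_ : N → N → Set) (r : N) →
              Action Γ _~T_ → Group.Carrier Γ → N → N → Set
ConeWitness {Γ} {N} _~T_ r αT g s t =
    (s ≡ r × t ≡ r × act g r ≡ r)
  ⊎ (s ≢ r × t ≢ r × act g s ≡ t ×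
     Σ N λ p → Parent _~T_ r s p × Parent _~T_ r t (act g p))
  where open Action αT

-- The t-graphs 𝒢(t) (multigraphs), described by the type of edges between
-- each ordered pair of vertices u, v.

module TGraph {V N : Set} (_~_ : V → V → Set) (_~T_ : N → N → Set)
              (𝒱 : N → V → Set) (r : N) where

  -- uv ∈ ℰ(t): an edge of G[𝒱(t)] which is not an edge of G[𝒱(t↑)]
  -- (for t = r there is no parent, so this is all of E(G[𝒱(r)]))
  RealEdge : N → V → V → Set
  RealEdge t u v = u ~ v × 𝒱 t u × 𝒱 t v × (∀ p → Parent _~T_ r t p → ¬ (𝒱 p u × 𝒱 p v))

  VirtualEdge : N → V → V → Set
  VirtualEdge t u v = Σ N λ t' → t' ~T t × 𝒱 t' u × 𝒱 t' v × 𝒱 t u × 𝒱 t v × u ≢ v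

  Edge : N → V → V → Set
  Edge t u v = RealEdge t u v ⊎ VirtualEdge t u v

  -- identity of edges: the (unique) real edge, resp. the virtual edge labelled by t'
  _≈E_ : ∀ {t u v} → Edge t u v → Edge t u v → Set
  inj₁ _        ≈E inj₁ _        = ⊤
  inj₁ _        ≈E inj₂ _        = ⊥
  inj₂ _        ≈E inj₁ _        = ⊥
  inj₂ (a , _)  ≈E inj₂ (b , _)  = a ≡ b

  private
    ≈E-refl : ∀ {t u v} (e : Edge t u v) → e ≈E e
    ≈E-refl (inj₁ _) = tt
    ≈E-refl (inj₂ _) = refl
    ≈E-sym : ∀ {t u v} {e f : Edge t u v} → e ≈E f → f ≈E e
    ≈E-sym {e = inj₁ _} {inj₁ _} _ = tt
    ≈E-sym {e = inj₂ _} {inj₂ _} p = sym p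
    ≈E-trans : ∀ {t u v} {e f h : Edge t u v} → e ≈E f → f ≈E h → e ≈E h
    ≈E-trans {e = inj₁ _} {inj₁ _} {inj₁ _} _ _ = tt
    ≈E-trans {e = inj₂ _} {inj₂ _} {inj₂ _} p q = trans p q

  EdgeSetoid : N → V → V → Setoid 0ℓ 0ℓ
  EdgeSetoid t u v = record
    { Carrier = Edge t u v
    ; _≈_ = _≈E_
    ; isEquivalence = record { refl = λ {e} → ≈E-refl e ; sym = ≈E-sym ; trans = ≈E-trans } }

  swapE : ∀ {t u v} → IsSimpleGraph _~_ → Edge t u v → Edge t v u
  swapE S (inj₁ (a , b , c , d)) =
    inj₁ (IsSimpleGraph.sym~ S a , c , b , λ p q x → d p q (proj₂ x , proj₁ x))
  swapE S (inj₂ (t' , a , b , c , d , e , f)) =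
    inj₂ (t' , a , c , b , e , d , λ eq → f (sym eq))

  ExtendsToIso : IsSimpleGraph _~_ → (V → V) → N → N → Set
  ExtendsToIso S φ s t =
      (∀ v → 𝒱 s v → 𝒱 t (φ v))
    × (∀ w → 𝒱 t w → Σ V λ v → 𝒱 s v × φ v ≡ w)
    × Σ (∀ u v → Inverse (EdgeSetoid s u v) (EdgeSetoid t (φ u) (φ v))) λ F →
        ∀ u v (e : Edge s u v) →
          Inverse.to (F v u) (swapE S e) ≈E swapE S (Inverse.to (F u v) e)

-- γ maps 𝒱(s) onto 𝒱(γ s) = 𝒱(t) by invariance. Since parents are unique in a tree,
-- γ also maps the parent of s to the parent of t, so a G-edge inside 𝒱(s) but not
-- inside 𝒱(s↑) goes to one inside 𝒱(t) but not inside 𝒱(t↑); and a virtual edge of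
-- the adhesion set with a neighbour s' of s goes to the virtual edge of the adhesion
-- set with the neighbour γ s' of t. Acting by γ⁻¹ gives the inverse bijection.
module Submission where

open import Defs
open import Level using (0ℓ)
open import Algebra.Bundles using (Group)
open import Data.Empty using (⊥-elim)
open import Data.Unit using (tt)
open import Data.Product using (Σ; _×_; _,_; proj₁; proj₂)
open import Data.Sum using (inj₁; inj₂)
open import Data.List using (_∷_; [])
open import Data.List.Relation.Unary.Any using (here; there)
open import Data.List.Relation.Unary.All as All using ()
open import Data.List.Relation.Unary.AllPairs using (_∷_)
open import Data.List.Membership.Propositional using (_∈_)
open import Relation.Nullary using (¬_)
open import Relation.Binary.PropositionalEquality
open import Function.Bundles using (Inverse)

walk-end-∈ : ∀ {A : Set} {R : A → A → Set} {a b x} xs → IsWalk R a (x ∷ xs) b → b ∈ x ∷ xs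
walk-end-∈ []       (_ , refl) = here refl
walk-end-∈ (_ ∷ ys) (_ , w)    = there (walk-end-∈ ys w)

root-has-no-parent : ∀ {N : Set} {R : N → N → Set} {r p : N} → ¬ Parent R r r p
root-has-no-parent (xs , w , (r∉ ∷ _)) = All.lookup r∉ (walk-end-∈ xs w) refl

parent-unique : ∀ {N : Set} {R : N → N → Set} → IsTree R → ∀ {r t p q} →
                Parent R r t p → Parent R r t q → p ≡ q
parent-unique T (_ , P) (_ , Q) with IsTree.uniquePaths T P Q
... | refl = refl

module ActionProperties {Γ : Group 0ℓ 0ℓ} {X : Set} {R : X → X → Set} (α : Action Γ R) where
  open Group Γ using (_∙_; ε; _⁻¹; inverseˡ; inverseʳ)
  open Action α
  open ≡-Reasoning

  act-inverseˡ : ∀ g x → act (g ⁻¹) (act g x) ≡ x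
  act-inverseˡ g x = begin
    act (g ⁻¹) (act g x) ≡⟨ act-∙ (g ⁻¹) g x ⟨
    act (g ⁻¹ ∙ g) x     ≡⟨ act-cong (inverseˡ g) x ⟩
    act ε x              ≡⟨ act-ε x ⟩
    x                    ∎

  act-inverseʳ : ∀ g x → act g (act (g ⁻¹) x) ≡ x
  act-inverseʳ g x = begin
    act g (act (g ⁻¹) x) ≡⟨ act-∙ g (g ⁻¹) x ⟨
    act (g ∙ g ⁻¹) x     ≡⟨ act-cong (inverseʳ g) x ⟩
    act ε x              ≡⟨ act-ε x ⟩
    x                    ∎

  act-injective : ∀ g {x y} → act g x ≡ act g y → x ≡ y
  act-injective g {x} {y} eq =
    trans (sym (act-inverseˡ g x)) (trans (cong (act (g ⁻¹)) eq) (act-inverseˡ g y))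

  act-adj⁺ : ∀ g {x y} → R x y → R (act g x) (act g y)
  act-adj⁺ g = proj₁ (act-adj g _ _)

  act-adj⁻ : ∀ g {x y} → R (act g x) (act g y) → R x y
  act-adj⁻ g = proj₂ (act-adj g _ _)

module Decomposition {V N : Set} (_~_ : V → V → Set) (_~T_ : N → N → Set)
  (𝒱 : N → V → Set) (r : N) {Γ : Group 0ℓ 0ℓ} (αG : Action Γ _~_) (αT : Action Γ _~T_)
  (inv : Invariant αG αT 𝒱) where

  open Group Γ using (Carrier; _⁻¹)
  open Action αG using () renaming (act to φ)
  open Action αT using () renaming (act to τ)
  open ActionProperties αG using (act-inverseˡ)
  open ActionProperties αT using () renaming (act-inverseˡ to τ-inverseˡ)

  𝒱-act : ∀ g {n v} → 𝒱 n v → 𝒱 (τ g n) (φ g v)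
  𝒱-act g = proj₁ (inv g _) _

  𝒱-act⁻¹ : ∀ g {n v} → 𝒱 n (φ g v) → 𝒱 (τ (g ⁻¹) n) v
  𝒱-act⁻¹ g {v = v} x = subst (𝒱 _) (act-inverseˡ g v) (𝒱-act (g ⁻¹) x)

  NotBothInParent : N → V → V → Set
  NotBothInParent t u v = ∀ p → Parent _~T_ r t p → ¬ (𝒱 p u × 𝒱 p v)

  ParentsMappedBy : Carrier → N → N → Set
  ParentsMappedBy g s t = ∀ p → Parent _~T_ r s p → Parent _~T_ r t (τ g p)

  notBothInParent-reflect : ∀ g {s t u v} → ParentsMappedBy g t s →
                            NotBothInParent s (φ g u) (φ g v) → NotBothInParent t u v
  notBothInParent-reflect g par h q q↑ (qu , qv) = h (τ g q) (par q q↑) (𝒱-act g qu , 𝒱-act g qv)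

  record ConeMap (g : Carrier) (s t : N) : Set where
    field
      moves    : τ g s ≡ t
      parents  : ParentsMappedBy g s t
      parents⁻ : ParentsMappedBy (g ⁻¹) t s

  coneWitness⇒coneMap : IsTree _~T_ → ∀ {g s t} → ConeWitness _~T_ r αT g s t → ConeMap g s t
  coneWitness⇒coneMap _ (inj₁ (refl , refl , gr≡r)) = record
    { moves    = gr≡r
    ; parents  = λ _ r↑ → ⊥-elim (root-has-no-parent r↑)
    ; parents⁻ = λ _ r↑ → ⊥-elim (root-has-no-parent r↑) }
  coneWitness⇒coneMap T {g} (inj₂ (_ , _ , gs≡t , p , s↑ , t↑)) = record
    { moves    = gs≡t
    ; parents  = λ p' s↑' → subst (λ x → Parent _~T_ r _ (τ g x)) (parent-unique T s↑ s↑') t↑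
    ; parents⁻ = λ q t↑' → subst (Parent _~T_ r _)
                   (sym (trans (cong (τ (g ⁻¹)) (parent-unique T t↑' t↑)) (τ-inverseˡ g p))) s↑ }

  module ConeIso (S : IsSimpleGraph _~_) {γ : Carrier} {s t : N} (cone : ConeMap γ s t) where
    open ConeMap cone
    open TGraph _~_ _~T_ 𝒱 r
    open ActionProperties αG using (act-injective; act-adj⁺; act-adj⁻)
    open ActionProperties αT using () renaming (act-adj⁺ to τ-adj⁺; act-inverseʳ to τ-inverseʳ)

    σt≡s : τ (γ ⁻¹) t ≡ s
    σt≡s = trans (cong (τ (γ ⁻¹)) (sym moves)) (τ-inverseˡ γ s)

    𝒱-to : ∀ {v} → 𝒱 s v → 𝒱 t (φ γ v)
    𝒱-to x = subst (λ n → 𝒱 n _) moves (𝒱-act γ x)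

    𝒱-from : ∀ {v} → 𝒱 t (φ γ v) → 𝒱 s v
    𝒱-from x = subst (λ n → 𝒱 n _) σt≡s (𝒱-act⁻¹ γ x)

    𝒱-onto : ∀ w → 𝒱 t w → Σ V λ v → 𝒱 s v × φ γ v ≡ w
    𝒱-onto w x = proj₂ (inv γ s) w (subst (λ n → 𝒱 n w) (sym moves) x)

    notBothInParent-to : ∀ {u v} → NotBothInParent s u v → NotBothInParent t (φ γ u) (φ γ v)
    notBothInParent-to {u} {v} h = notBothInParent-reflect (γ ⁻¹) parents⁻
      (subst₂ (NotBothInParent s) (sym (act-inverseˡ γ u)) (sym (act-inverseˡ γ v)) h)

    notBothInParent-from : ∀ {u v} → NotBothInParent t (φ γ u) (φ γ v) → NotBothInParent s u v
    notBothInParent-from = notBothInParent-reflect γ parents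

    to : ∀ {u v} → Edge s u v → Edge t (φ γ u) (φ γ v)
    to (inj₁ (uv , su , sv , h)) =
      inj₁ (act-adj⁺ γ uv , 𝒱-to su , 𝒱-to sv , notBothInParent-to h)
    to (inj₂ (s' , s'~s , s'u , s'v , su , sv , u≢v)) =
      inj₂ (τ γ s' , subst (τ γ s' ~T_) moves (τ-adj⁺ γ s'~s) ,
            𝒱-act γ s'u , 𝒱-act γ s'v , 𝒱-to su , 𝒱-to sv , λ eq → u≢v (act-injective γ eq))

    from : ∀ {u v} → Edge t (φ γ u) (φ γ v) → Edge s u v
    from (inj₁ (uv , tu , tv , h)) =
      inj₁ (act-adj⁻ γ uv , 𝒱-from tu , 𝒱-from tv , notBothInParent-from h)
    from (inj₂ (t' , t'~t , t'u , t'v , tu , tv , u≢v)) =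
      inj₂ (τ (γ ⁻¹) t' , subst (τ (γ ⁻¹) t' ~T_) σt≡s (τ-adj⁺ (γ ⁻¹) t'~t) ,
            𝒱-act⁻¹ γ t'u , 𝒱-act⁻¹ γ t'v , 𝒱-from tu , 𝒱-from tv , λ eq → u≢v (cong (φ γ) eq))

    to-cong : ∀ {u v} {e f : Edge s u v} → e ≈E f → to e ≈E to f
    to-cong {e = inj₁ _} {inj₁ _} _  = tt
    to-cong {e = inj₂ _} {inj₂ _} eq = cong (τ γ) eq

    from-cong : ∀ {u v} {e f : Edge t (φ γ u) (φ γ v)} → e ≈E f → from e ≈E from f
    from-cong {e = inj₁ _} {inj₁ _} _  = tt
    from-cong {e = inj₂ _} {inj₂ _} eq = cong (τ (γ ⁻¹)) eq

    to-inverse : ∀ {u v} {f : Edge t (φ γ u) (φ γ v)} {e : Edge s u v} → e ≈E from f → to e ≈E f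
    to-inverse {f = inj₁ _}       {inj₁ _} _  = tt
    to-inverse {f = inj₂ (t' , _)} {inj₂ _} eq = trans (cong (τ γ) eq) (τ-inverseʳ γ t')

    from-inverse : ∀ {u v} {e : Edge s u v} {f : Edge t (φ γ u) (φ γ v)} → f ≈E to e → from f ≈E e
    from-inverse {e = inj₁ _}       {inj₁ _} _  = tt
    from-inverse {e = inj₂ (s' , _)} {inj₂ _} eq = trans (cong (τ (γ ⁻¹)) eq) (τ-inverseˡ γ s')

    edgeInverse : ∀ u v → Inverse (EdgeSetoid s u v) (EdgeSetoid t (φ γ u) (φ γ v))
    edgeInverse u v = record
      { to = to ; from = from ; to-cong = to-cong ; from-cong = from-cong
      ; inverse = (λ {f} {e} → to-inverse {f = f} {e}) , (λ {e} {f} → from-inverse {e = e} {f}) }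

    to-swapE : ∀ {u v} (e : Edge s u v) → to (swapE S e) ≈E swapE S (to e)
    to-swapE (inj₁ _) = tt
    to-swapE (inj₂ _) = refl

    extendsToIso : ExtendsToIso S (φ γ) s t
    extendsToIso = (λ _ → 𝒱-to) , 𝒱-onto , edgeInverse , λ _ _ → to-swapE

lemma3p6 : {V N : Set} (_~_ : V → V → Set) (o : V)
    (S : IsSimpleGraph _~_) → LocallyFinite _~_ → Connected _~_ →
    (Γ : Group 0ℓ 0ℓ) (αG : Action Γ _~_) → Faithful αG →
    (_~T_ : N → N → Set) → IsTree _~T_ →
    (𝒱 : N → V → Set) → IsTreeDecomposition _~_ _~T_ 𝒱 →
    (r : N) → 𝒱 r o →
    (αT : Action Γ _~T_) → Invariant αG αT 𝒱 →
    (s t : N) (γ : Group.Carrier Γ) → ConeWitness _~T_ r αT γ s t →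
    TGraph.ExtendsToIso _~_ _~T_ 𝒱 r S (Action.act αG γ) s t
lemma3p6 _~_ _ S _ _ _ αG _ _~T_ T 𝒱 _ r _ αT inv _ _ _ witness =
  ConeIso.extendsToIso S (coneWitness⇒coneMap T witness)
  where open Decomposition _~_ _~T_ 𝒱 r αG αT inv
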